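{- Let $t$ be the Thue–Morse word, the fixed point starting with $a$ of the morphism $a\mapsto abba$, $b\mapsto baab$. Let $i>0$ and $k>0$ be integers such that $t(i..i+k]$ is a palindrome and, for some $m\in\{1,2,3\}$, $i\equiv m\pmod 4$ and $i+k\equiv 4-m\pmod 4$. Then $t(i-1..i+k+1]$ is a palindrome, and $t(i+1..i+k-1]$ is a palindrome.
   Context: For a word $w=w[1]w[2]\cdots$, $w(i..j]$ denotes the factor $w[i+1]\cdots w[j]$ (empty if $i=j$; the empty word counts as a palindrome). A palindrome is a word equal to its reversal. -}

module Defs where

open import Data.Nat using (ℕ; zero; suc; _+_; _∸_)
open import Data.List using (List; []; _∷_; _++_; concatMap; reverse; map)
open import Data.List.Base using (applyUpTo)
open import Relation.Binary.PropositionalEquality using (_≡_)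

data Letter : Set where
  a b : Letter

μ : Letter → List Letter
μ a = a ∷ b ∷ b ∷ a ∷ []
μ b = b ∷ a ∷ a ∷ b ∷ []

μ* : List Letter → List Letter
μ* = concatMap μ

iter : ℕ → List Letter
iter zero = a ∷ []
iter (suc n) = μ* (iter n)

-- the Thue–Morse word t = lim μ^n(a) (fixed point starting with a),
-- 1-indexed: t j = t[j] is the j-th letter of μ^j(a), which has length 4^j ≥ j
-- (μ^n(a) is a prefix of μ^(n+1)(a), so this is the letter of the fixed point).
-- t 0 is a meaningless default.
-- nth letter (0-indexed) of a list, default a when out of range
nth : List Letter → ℕ → Letter
nth [] _ = a
nth (x ∷ _) zero = x
nth (_ ∷ xs) (suc n) = nth xs n

t : ℕ → Letter
t zero = a
t (suc j) = nth (iter (suc j)) j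

-- factor w(i..j] = w[i+1] ⋯ w[j]  (empty if j ≤ i)
factor : (ℕ → Letter) → ℕ → ℕ → List Letter
factor w i j = applyUpTo (λ r → w (suc (i + r))) (j ∸ i)

IsPalindrome : List Letter → Set
IsPalindrome u = reverse u ≡ u

module Submission where

-- Cut t into the blocks t(4q..4q+4] = μ(t[q+1]).  Both blocks μ(a) = abba
-- and μ(b) = baab are palindromes, and two blocks that agree at one position are equal.
-- Under the residue hypothesis the letters t[i], t[i+1] lie in one block and t[i+k],
-- t[i+k+1] in another, at mirror positions (r, r+1) and (3-r-1, 3-r).  The palindrome
-- t(i..i+k] gives t[i+1] = t[i+k]; hence the two blocks coincide, and reading them at the
-- mirror positions r and 3-r gives t[i] = t[i+k+1].  So the palindrome extends by one
-- letter on each side, while removing one letter on each side of a palindrome is trivial.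

open import Defs
open import Data.Nat using (ℕ; zero; suc; _+_; _*_; _∸_; _%_; _/_; _<_; _≤_; _≤′_; ≤′-refl; ≤′-step; _≤?_; z≤n; s≤s)
open import Data.Nat.Properties
open import Data.Nat.DivMod using (m≡m%n+[m/n]*n; m<n⇒m%n≡m)
open import Data.List using ([]; _∷_; _++_; reverse; length; _∷ʳ_)
open import Data.List.Base using (applyUpTo)
open import Data.List.Properties
  using (++-identityʳ; ++-assoc; concatMap-++; reverse-++; unfold-reverse; applyUpTo-∷ʳ;
         ∷-injective; ∷ʳ-injectiveˡ)
open import Data.Product using (_×_; ∃-syntax; _,_; proj₁; proj₂)
open import Data.Sum using (inj₁; inj₂)
open import Relation.Nullary using (yes; no)
open import Relation.Binary.PropositionalEquality

reverse-wrap : ∀ {A : Set} (x y : A) L → reverse (x ∷ (L ∷ʳ y)) ≡ y ∷ (reverse L ∷ʳ x)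
reverse-wrap x y L = trans (unfold-reverse x (L ∷ʳ y)) (cong (_∷ʳ x) (reverse-++ L (y ∷ [])))

palindrome-wrap : ∀ (x y : Letter) L → x ≡ y → IsPalindrome L → IsPalindrome (x ∷ (L ∷ʳ y))
palindrome-wrap x .x L refl pal = trans (reverse-wrap x x L) (cong (λ M → x ∷ (M ∷ʳ x)) pal)

palindrome-unwrap : ∀ (x y : Letter) L → IsPalindrome (x ∷ (L ∷ʳ y)) → x ≡ y × IsPalindrome L
palindrome-unwrap x y L pal with ∷-injective (trans (sym (reverse-wrap x y L)) pal)
... | y≡x , inner = sym y≡x , ∷ʳ-injectiveˡ (reverse L) L inner

applyUpTo-cong : ∀ {f g : ℕ → Letter} → (∀ r → f r ≡ g r) → ∀ n → applyUpTo f n ≡ applyUpTo g n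
applyUpTo-cong f≗g zero = refl
applyUpTo-cong f≗g (suc n) = cong₂ _∷_ (f≗g 0) (applyUpTo-cong (λ r → f≗g (suc r)) n)

short-factor-palindrome : ∀ w {i j} → j ≤ i → IsPalindrome (factor w i j)
short-factor-palindrome w j≤i rewrite m≤n⇒m∸n≡0 j≤i = refl

factor-cons : ∀ w {i j} → i < j → factor w i j ≡ w (suc i) ∷ factor w (suc i) j
factor-cons w {i} {suc j} (s≤s i≤j) = begin
  applyUpTo f (suc j ∸ i)        ≡⟨ cong (applyUpTo f) (+-∸-assoc 1 i≤j) ⟩
  f 0 ∷ applyUpTo (λ r → f (suc r)) (j ∸ i)
    ≡⟨ cong₂ _∷_ (cong (λ n → w (suc n)) (+-identityʳ i))
                 (applyUpTo-cong (λ r → cong (λ n → w (suc n)) (+-suc i r)) (j ∸ i)) ⟩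
  w (suc i) ∷ factor w (suc i) (suc j) ∎
  where
  open ≡-Reasoning
  f : ℕ → Letter
  f r = w (suc (i + r))

factor-snoc : ∀ w {i j} → i ≤ j → factor w i (suc j) ≡ factor w i j ∷ʳ w (suc j)
factor-snoc w {i} {j} i≤j = begin
  applyUpTo f (suc j ∸ i)           ≡⟨ cong (applyUpTo f) (+-∸-assoc 1 i≤j) ⟩
  applyUpTo f (suc (j ∸ i))         ≡⟨ sym (applyUpTo-∷ʳ f (j ∸ i)) ⟩
  applyUpTo f (j ∸ i) ∷ʳ f (j ∸ i)  ≡⟨ cong (λ n → factor w i j ∷ʳ w (suc n)) (m+[n∸m]≡n i≤j) ⟩
  factor w i j ∷ʳ w (suc j)         ∎
  where
  open ≡-Reasoning
  f : ℕ → Letter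
  f r = w (suc (i + r))

factor-peel : ∀ w {i j} → suc i ≤ j →
  factor w i (suc j) ≡ w (suc i) ∷ (factor w (suc i) j ∷ʳ w (suc j))
factor-peel w i<j =
  trans (factor-cons w (s≤s (<⇒≤ i<j))) (cong (w (suc _) ∷_) (factor-snoc w i<j))

palindrome-ends : ∀ w {i j} → i < j → IsPalindrome (factor w i j) → w (suc i) ≡ w j
palindrome-ends w {i} {suc j} (s≤s i≤j) pal with m≤n⇒m<n∨m≡n i≤j
... | inj₂ refl = refl
... | inj₁ i<j = proj₁ (palindrome-unwrap _ _ _ (subst IsPalindrome (factor-peel w i<j) pal))

palindrome-extend : ∀ w {i j} → i < j → IsPalindrome (factor w (suc i) j) →
  w (suc i) ≡ w (suc j) → IsPalindrome (factor w i (j + 1))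
palindrome-extend w {i} {j} i<j pal ends =
  subst IsPalindrome (sym (trans (cong (factor w i) (+-comm j 1)) (factor-peel w i<j)))
    (palindrome-wrap _ _ _ ends pal)

palindrome-shrink : ∀ w {i j} → IsPalindrome (factor w i j) →
  IsPalindrome (factor w (i + 1) (j ∸ 1))
palindrome-shrink w {i} {zero} _ = short-factor-palindrome w z≤n
palindrome-shrink w {i} {suc j} pal with suc i ≤? j
... | yes i<j = subst (λ n → IsPalindrome (factor w n j)) (+-comm 1 i)
      (proj₂ (palindrome-unwrap _ _ _ (subst IsPalindrome (factor-peel w i<j) pal)))
... | no i≮j = short-factor-palindrome w (≤-trans (≤-pred (≰⇒> i≮j)) (m≤m+n i 1))

μ-palindrome : ∀ x r s → r + s ≡ 3 → nth (μ x) r ≡ nth (μ x) s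
μ-palindrome a 0 .3 refl = refl
μ-palindrome a 1 .2 refl = refl
μ-palindrome a 2 .1 refl = refl
μ-palindrome a 3 .0 refl = refl
μ-palindrome b 0 .3 refl = refl
μ-palindrome b 1 .2 refl = refl
μ-palindrome b 2 .1 refl = refl
μ-palindrome b 3 .0 refl = refl
μ-palindrome _ (suc (suc (suc (suc r)))) s ()

μ-injective-at : ∀ x y r → r < 4 → nth (μ x) r ≡ nth (μ y) r → x ≡ y
μ-injective-at a a r _ _ = refl
μ-injective-at b b r _ _ = refl
μ-injective-at a b 0 _ ()
μ-injective-at a b 1 _ ()
μ-injective-at a b 2 _ ()
μ-injective-at a b 3 _ ()
μ-injective-at b a 0 _ ()
μ-injective-at b a 1 _ ()
μ-injective-at b a 2 _ ()
μ-injective-at b a 3 _ ()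
μ-injective-at _ _ (suc (suc (suc (suc r)))) (s≤s (s≤s (s≤s (s≤s ())))) _

summands-below-4 : ∀ r s → r + s ≡ 3 → r < 4 × s < 4
summands-below-4 r s sum =
  s≤s (subst (r ≤_) sum (m≤m+n r s)) , s≤s (subst (s ≤_) sum (m≤n+m s r))

μ-mirror : ∀ x y r s → suc r + s ≡ 3 → nth (μ x) (suc r) ≡ nth (μ y) s →
  nth (μ x) r ≡ nth (μ y) (suc s)
μ-mirror x y r s sum e = begin
  nth (μ x) r        ≡⟨ μ-palindrome x r (suc s) (trans (+-suc r s) sum) ⟩
  nth (μ x) (suc s)  ≡⟨ cong (λ z → nth (μ z) (suc s)) x≡y ⟩
  nth (μ y) (suc s)  ∎
  where
  open ≡-Reasoning
  x≡y : x ≡ y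
  x≡y = μ-injective-at x y (suc r) (proj₁ (summands-below-4 (suc r) s sum))
          (trans e (sym (μ-palindrome y (suc r) s sum)))

length-μ* : ∀ w → length (μ* w) ≡ length w * 4
length-μ* [] = refl
length-μ* (a ∷ w) = cong (λ n → 4 + n) (length-μ* w)
length-μ* (b ∷ w) = cong (λ n → 4 + n) (length-μ* w)

iter-long : ∀ n → n < length (iter n)
iter-long zero = s≤s z≤n
iter-long (suc n) = subst (suc n <_) (sym (length-μ* (iter n))) (begin-strict
  suc n                                  <⟨ m<m+n (suc n) (s≤s z≤n) ⟩
  suc n + suc n                          ≤⟨ +-mono-≤ (iter-long n) (iter-long n) ⟩
  length (iter n) + length (iter n)      ≤⟨ +-monoʳ-≤ (length (iter n)) (m≤m*n _ 3) ⟩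
  length (iter n) + length (iter n) * 3  ≡⟨ *-suc (length (iter n)) 3 ⟨
  length (iter n) * 4                    ∎)
  where open ≤-Reasoning

iter-prefix-suc : ∀ n → ∃[ ys ] iter (suc n) ≡ iter n ++ ys
iter-prefix-suc zero = _ , refl
iter-prefix-suc (suc n) with iter-prefix-suc n
... | ys , e = μ* ys , trans (cong μ* e) (concatMap-++ μ (iter n) ys)

iter-prefix : ∀ {n n′} → n ≤ n′ → ∃[ ys ] iter n′ ≡ iter n ++ ys
iter-prefix {n} n≤n′ = go (≤⇒≤′ n≤n′)
  where
  go : ∀ {n′} → n ≤′ n′ → ∃[ ys ] iter n′ ≡ iter n ++ ys
  go ≤′-refl = [] , sym (++-identityʳ (iter n))
  go (≤′-step {n′} p) with go p | iter-prefix-suc n′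
  ... | ys , e | zs , e′ = ys ++ zs , trans e′ (trans (cong (_++ zs) e) (++-assoc (iter n) ys zs))

nth-++ˡ : ∀ xs ys q → q < length xs → nth (xs ++ ys) q ≡ nth xs q
nth-++ˡ (x ∷ xs) ys zero _ = refl
nth-++ˡ (x ∷ xs) ys (suc q) (s≤s q<) = nth-++ˡ xs ys q q<

nth-++ʳ : ∀ xs ys n → nth (xs ++ ys) (length xs + n) ≡ nth ys n
nth-++ʳ [] ys n = refl
nth-++ʳ (x ∷ xs) ys n = nth-++ʳ xs ys n

iter-stable : ∀ {n n′} q → n ≤ n′ → q < length (iter n) → nth (iter n′) q ≡ nth (iter n) q
iter-stable {n} q n≤n′ q< with iter-prefix n≤n′
... | ys , e = trans (cong (λ w → nth w q) e) (nth-++ˡ (iter n) ys q q<)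

length-μ : ∀ x → length (μ x) ≡ 4
length-μ a = refl
length-μ b = refl

nth-μ* : ∀ w q r → r < 4 → q < length w → nth (μ* w) (r + q * 4) ≡ nth (μ (nth w q)) r
nth-μ* (x ∷ w) zero r r<4 _ =
  trans (cong (nth (μ x ++ μ* w)) (+-identityʳ r))
        (nth-++ˡ (μ x) (μ* w) r (subst (r <_) (sym (length-μ x)) r<4))
nth-μ* (x ∷ w) (suc q) r r<4 (s≤s q<) = begin
  nth (μ x ++ μ* w) (r + suc q * 4)           ≡⟨ cong (nth (μ x ++ μ* w)) shift ⟩
  nth (μ x ++ μ* w) (length (μ x) + (r + q * 4)) ≡⟨ nth-++ʳ (μ x) (μ* w) (r + q * 4) ⟩
  nth (μ* w) (r + q * 4)                      ≡⟨ nth-μ* w q r r<4 q< ⟩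
  nth (μ (nth w q)) r                         ∎
  where
  open ≡-Reasoning
  shift : r + suc q * 4 ≡ length (μ x) + (r + q * 4)
  shift = trans (+-comm r (suc q * 4))
                (cong₂ _+_ (sym (length-μ x)) (+-comm (q * 4) r))

-- The q-th letter of t, counted from 0 (that is, t[q+1]).
letter : ℕ → Letter
letter q = nth (iter q) q

t-block : ∀ q r → r < 4 → t (suc (r + q * 4)) ≡ nth (μ (letter q)) r
t-block q r r<4 = begin
  t (suc j)                        ≡⟨⟩
  nth (μ* (iter j)) j              ≡⟨ nth-μ* (iter j) q r r<4 (≤-<-trans q≤j (iter-long j)) ⟩
  nth (μ (nth (iter j) q)) r       ≡⟨ cong (λ x → nth (μ x) r) (iter-stable q q≤j (iter-long q)) ⟩
  nth (μ (letter q)) r             ∎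
  where
  open ≡-Reasoning
  j : ℕ
  j = r + q * 4
  q≤j : q ≤ j
  q≤j = ≤-trans (m≤m*n q 4) (m≤n+m (q * 4) r)

t-mirror-blocks : ∀ q p r s → suc r + s ≡ 3 →
  t (suc (suc r + q * 4)) ≡ t (suc (s + p * 4)) → t (suc (r + q * 4)) ≡ t (suc (suc s + p * 4))
t-mirror-blocks q p r s sum e = begin
  t (suc (r + q * 4))          ≡⟨ t-block q r (proj₁ r<4×s+1<4) ⟩
  nth (μ (letter q)) r         ≡⟨ μ-mirror (letter q) (letter p) r s sum inner ⟩
  nth (μ (letter p)) (suc s)   ≡⟨ sym (t-block p (suc s) (proj₂ r<4×s+1<4)) ⟩
  t (suc (suc s + p * 4))      ∎
  where
  open ≡-Reasoning
  r+1<4×s<4 : suc r < 4 × s < 4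
  r+1<4×s<4 = summands-below-4 (suc r) s sum
  r<4×s+1<4 : r < 4 × suc s < 4
  r<4×s+1<4 = summands-below-4 r (suc s) (trans (+-suc r s) sum)
  inner : nth (μ (letter q)) (suc r) ≡ nth (μ (letter p)) s
  inner = trans (sym (t-block q (suc r) (proj₁ r+1<4×s<4)))
                (trans e (t-block p s (proj₂ r+1<4×s<4)))

residue-form : ∀ i {m} → m < 4 → i % 4 ≡ m % 4 → i ≡ m + i / 4 * 4
residue-form i m<4 e = trans (m≡m%n+[m/n]*n i 4) (cong (_+ i / 4 * 4) (trans e (m<n⇒m%n≡m m<4)))

t-mirror : ∀ i j m → 1 ≤ m → m ≤ 3 → i % 4 ≡ m % 4 → j % 4 ≡ (4 ∸ m) % 4 →
  t (suc i) ≡ t j → t i ≡ t (suc j)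
t-mirror i j (suc r) _ (s≤s r≤2) i≡m j≡4-m =
  subst₂ (λ i j → t (suc i) ≡ t j → t i ≡ t (suc j)) (sym i-form) (sym j-form)
    (t-mirror-blocks (i / 4) (j / 4) r (2 ∸ r) (cong suc (m+[n∸m]≡n r≤2)))
  where
  i-form : i ≡ suc r + i / 4 * 4
  i-form = residue-form i (s≤s (s≤s r≤2)) i≡m
  j-form : j ≡ suc (2 ∸ r) + j / 4 * 4
  j-form = trans (residue-form j (s≤s (m∸n≤m 3 r)) j≡4-m)
                 (cong (_+ j / 4 * 4) (+-∸-assoc 1 r≤2))

proposition6 : (i k : ℕ) → 0 < i → 0 < k →
    IsPalindrome (factor t i (i + k)) →
    (∃[ m ] (1 ≤ m × m ≤ 3 × i % 4 ≡ m % 4 × (i + k) % 4 ≡ (4 ∸ m) % 4)) →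
    IsPalindrome (factor t (i ∸ 1) (i + k + 1)) × IsPalindrome (factor t (i + 1) (i + k ∸ 1))
proposition6 i@(suc _) k _ 0<k pal (m , 1≤m , m≤3 , i≡m , i+k≡4-m) =
  palindrome-extend t (m≤m+n i k) pal outer-ends , palindrome-shrink t {i} {i + k} pal
  where
  outer-ends : t i ≡ t (suc (i + k))
  outer-ends = t-mirror i (i + k) m 1≤m m≤3 i≡m i+k≡4-m (palindrome-ends t (m<m+n i 0<k) pal)
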